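{- If $A,B\subseteq\omega$ are intrinsically small, then $A\oplus B=\{2n:n\in A\}\cup\{2n+1:n\in B\}$ is intrinsically small.
   Context: For $A\subseteq\omega$ and $n\geq 1$, $\rho_n(A)=|A\cap\{0,\dots,n-1\}|/n$ and $\overline{\rho}(A)=\limsup_n\rho_n(A)$. A set $A$ is intrinsically small if it has intrinsic density $0$, i.e. $\overline{\rho}(\pi(A))=0$ for every computable permutation $\pi$ of $\omega$ (the paper uses this term for infinite sets). -}

module Defs where

open import Data.Nat using (ℕ; zero; suc; _+_; _*_; _≤_; _<_; _/_; _%_; _≡ᵇ_)
open import Data.Bool using (Bool; true; false; if_then_else_)
open import Data.Fin using (Fin)
open import Data.Vec using (Vec; []; _∷_; lookup; [_])
open import Data.Product using (Σ; ∃; _×_; _,_)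
open import Relation.Binary.PropositionalEquality using (_≡_)

Subset : Set
Subset = ℕ → Bool

data PR : ℕ → Set where
  zeroF : ∀ {k} → PR k
  succF : PR 1
  proj  : ∀ {k} → Fin k → PR k
  comp  : ∀ {k m} → PR m → Vec (PR k) m → PR k
  prec  : ∀ {k} → PR k → PR (suc (suc k)) → PR (suc k)
  mu    : ∀ {k} → PR (suc k) → PR k

mutual
  data Eval : ∀ {k} → PR k → Vec ℕ k → ℕ → Set where
    evZero : ∀ {k} {xs : Vec ℕ k} → Eval zeroF xs 0
    evSucc : ∀ {x} → Eval succF (x ∷ []) (suc x)
    evProj : ∀ {k} {i : Fin k} {xs : Vec ℕ k} → Eval (proj i) xs (lookup xs i)
    evComp : ∀ {k m} {f : PR m} {gs : Vec (PR k) m} {xs : Vec ℕ k}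
               {ys : Vec ℕ m} {y : ℕ} →
             EvalAll gs xs ys → Eval f ys y → Eval (comp f gs) xs y
    evPrec0 : ∀ {k} {g : PR k} {h : PR (suc (suc k))} {xs : Vec ℕ k} {y} →
              Eval g xs y → Eval (prec g h) (0 ∷ xs) y
    evPrecS : ∀ {k} {g : PR k} {h : PR (suc (suc k))} {xs : Vec ℕ k} {n r y} →
              Eval (prec g h) (n ∷ xs) r → Eval h (n ∷ r ∷ xs) y →
              Eval (prec g h) (suc n ∷ xs) y
    evMu : ∀ {k} {f : PR (suc k)} {xs : Vec ℕ k} {y} →
           Eval f (y ∷ xs) 0 →
           (∀ z → z < y → Σ ℕ λ w → Eval f (z ∷ xs) (suc w)) →
           Eval (mu f) xs y

  data EvalAll : ∀ {k m} → Vec (PR k) m → Vec ℕ k → Vec ℕ m → Set where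
    evNil  : ∀ {k} {xs : Vec ℕ k} → EvalAll [] xs []
    evCons : ∀ {k m} {g : PR k} {gs : Vec (PR k) m} {xs : Vec ℕ k} {y ys} →
             Eval g xs y → EvalAll gs xs ys → EvalAll (g ∷ gs) xs (y ∷ ys)

Computable : (ℕ → ℕ) → Set
Computable f = Σ (PR 1) λ e → ∀ n → Eval e [ n ] (f n)

-- A computable permutation of ω: a computable bijection, given together
-- with its (set-theoretic) inverse.
record ComputablePerm : Set where
  field
    fun      : ℕ → ℕ
    inv      : ℕ → ℕ
    inv-fun  : ∀ n → inv (fun n) ≡ n
    fun-inv  : ∀ n → fun (inv n) ≡ n
    computable : Computable fun

-- Image π(A) = {π(a) : a ∈ A}:  m ∈ π(A)  iff  π⁻¹(m) ∈ A.
image : ComputablePerm → Subset → Subset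
image π A m = A (ComputablePerm.inv π m)

count : Subset → ℕ → ℕ
count A zero = zero
count A (suc n) = count A n + (if A n then 1 else 0)

-- upper density 0:  limsup_n ρ_n(A) = 0, i.e. for every k, eventually
-- ρ_n(A) ≤ 1/(k+1).
UpperDensityZero : Subset → Set
UpperDensityZero A = ∀ k → ∃ λ N → ∀ n → N ≤ n → suc k * count A n ≤ n

Infinite : Subset → Set
Infinite A = ∀ n → ∃ λ m → n ≤ m × A m ≡ true

IntrinsicDensityZero : Subset → Set
IntrinsicDensityZero A = ∀ (π : ComputablePerm) → UpperDensityZero (image π A)

-- Paper's convention: intrinsically small = infinite with intrinsic density 0.
IntrinsicallySmall : Subset → Set
IntrinsicallySmall A = Infinite A × IntrinsicDensityZero A

_⊕_ : Subset → Subset → Subset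
(A ⊕ B) m = if m % 2 ≡ᵇ 0 then A (m / 2) else B (m / 2)

-- Intrinsic density zero is closed under subsets, finite unions and images
-- under computable permutations, since π applied to the image of X under ρ
-- is the image of X under π ∘ ρ. No permutation sends every a to 2a, but a
-- computable involution does so on the odd a, and a composite of three
-- involutions on the even a; hence {2a : a ∈ A} is covered by two computable images of A, and
-- A ⊕ B by these together with the image of {2b : b ∈ B} under 2k ↔ 2k + 1.

module Submission where

open import Defs
open import Function using (_∘_)
open import Data.Nat using (ℕ; zero; suc; _+_; _*_; _≤_; _<_; _/_; _%_; _⊔_; z≤n; s≤s)
open import Data.Nat.Properties
open import Data.Nat.DivMod using (m*n%n≡0; m*n/n≡m; [m+kn]%n≡m%n; +-distrib-/)
open import Data.Nat.Tactic.RingSolver using (solve-∀)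
open import Data.Bool using (Bool; true; false; if_then_else_; _∨_)
open import Data.Bool.Properties using (∨-zeroʳ)
open import Data.Fin using () renaming (zero to #0; suc to #s)
open import Data.Vec using ([]; _∷_; [_])
open import Data.Product using (_,_)
open import Relation.Binary.PropositionalEquality
  using (_≡_; refl; sym; trans; cong; subst; module ≡-Reasoning)

dbl : ℕ → ℕ
dbl zero = zero
dbl (suc n) = suc (suc (dbl n))

data Parity : ℕ → Set where
  even : ∀ k → Parity (dbl k)
  odd  : ∀ k → Parity (suc (dbl k))

parity : ∀ n → Parity n
parity zero = even zero
parity (suc n) with parity n
... | even k = odd k
... | odd k = even (suc k)

dbl≡*2 : ∀ n → dbl n ≡ n * 2
dbl≡*2 zero = refl
dbl≡*2 (suc n) = cong (suc ∘ suc) (dbl≡*2 n)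

n≤dbl : ∀ n → n ≤ dbl n
n≤dbl n = subst (n ≤_) (sym (dbl≡*2 n)) (m≤m*n n 2)

cond : ℕ → ℕ → ℕ → ℕ
cond zero x y = x
cond (suc _) x y = y

par : ℕ → ℕ
par zero = 0
par (suc n) = cond (par n) 1 0

half : ℕ → ℕ
half zero = 0
half (suc n) = cond (par n) (half n) (suc (half n))

par-dbl : ∀ k → par (dbl k) ≡ 0
par-dbl zero = refl
par-dbl (suc k) rewrite par-dbl k = refl

par-suc-dbl : ∀ k → par (suc (dbl k)) ≡ 1
par-suc-dbl k rewrite par-dbl k = refl

half-dbl : ∀ k → half (dbl k) ≡ k
half-suc-dbl : ∀ k → half (suc (dbl k)) ≡ k
half-dbl zero = refl
half-dbl (suc k) rewrite par-suc-dbl k | half-suc-dbl k = refl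
half-suc-dbl k rewrite par-dbl k | half-dbl k = refl

byParity : (ℕ → ℕ) → (ℕ → ℕ) → ℕ → ℕ
byParity g h n = cond (par n) (g (half n)) (h (half n))

byParity-dbl : ∀ g h k → byParity g h (dbl k) ≡ g k
byParity-dbl g h k rewrite par-dbl k | half-dbl k = refl

byParity-suc-dbl : ∀ g h k → byParity g h (suc (dbl k)) ≡ h k
byParity-suc-dbl g h k rewrite par-suc-dbl k | half-suc-dbl k = refl

infixr 9 _∙_

_∙_ : ∀ {k} → PR 1 → PR k → PR k
f ∙ g = comp f (g ∷ [])

eval-∙ : ∀ {k} {f : PR 1} {g : PR k} {xs y z} →
         Eval g xs y → Eval f [ y ] z → Eval (f ∙ g) xs z
eval-∙ p q = evComp (evCons p evNil) q

condF : ∀ {k} → PR k → PR k → PR k → PR k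
condF c f g = comp (prec (proj #0) (proj (#s (#s (#s #0))))) (c ∷ f ∷ g ∷ [])

eval-cond : ∀ {k} {c f g : PR k} {xs a x y} →
            Eval c xs a → Eval f xs x → Eval g xs y → Eval (condF c f g) xs (cond a x y)
eval-cond {a = a} {x} {y} p q r = evComp (evCons p (evCons q (evCons r evNil))) (select a)
  where
  select : ∀ a →
           Eval (prec (proj #0) (proj (#s (#s (#s #0))))) (a ∷ x ∷ y ∷ []) (cond a x y)
  select zero = evPrec0 evProj
  select (suc a) = evPrecS (select a) evProj

parF : PR 1
parF = prec zeroF (condF (proj (#s #0)) (succF ∙ zeroF) zeroF)

eval-par : ∀ n → Eval parF [ n ] (par n)
eval-par zero = evPrec0 evZero
eval-par (suc n) = evPrecS (eval-par n) (eval-cond evProj (eval-∙ evZero evSucc) evZero)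

halfF : PR 1
halfF = prec zeroF (condF (parF ∙ proj #0) (proj (#s #0)) (succF ∙ proj (#s #0)))

eval-half : ∀ n → Eval halfF [ n ] (half n)
eval-half zero = evPrec0 evZero
eval-half (suc n) =
  evPrecS (eval-half n) (eval-cond (eval-∙ evProj (eval-par n)) evProj (eval-∙ evProj evSucc))

computable-suc : Computable suc
computable-suc = succF , λ n → evSucc

computable-dbl : Computable dbl
computable-dbl = prec zeroF (succF ∙ succF ∙ proj (#s #0)) , eval
  where
  eval : ∀ n → Eval (prec zeroF (succF ∙ succF ∙ proj (#s #0))) [ n ] (dbl n)
  eval zero = evPrec0 evZero
  eval (suc n) = evPrecS (eval n) (eval-∙ (eval-∙ evProj evSucc) evSucc)

computable-∘ : ∀ {f g} → Computable f → Computable g → Computable (f ∘ g)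
computable-∘ {g = g} (e , ev-f) (d , ev-g) = e ∙ d , λ n → eval-∙ (ev-g n) (ev-f (g n))

computable-byParity : ∀ {g h} → Computable g → Computable h → Computable (byParity g h)
computable-byParity {g} {h} (e , ev-g) (d , ev-h) =
  condF (parF ∙ proj #0) (e ∙ halfF ∙ proj #0) (d ∙ halfF ∙ proj #0) , λ n →
    eval-cond (eval-∙ evProj (eval-par n))
              (eval-∙ (eval-∙ evProj (eval-half n)) (ev-g (half n)))
              (eval-∙ (eval-∙ evProj (eval-half n)) (ev-h (half n)))

involution : (f : ℕ → ℕ) → (∀ n → f (f n) ≡ n) → Computable f → ComputablePerm
involution f ff≡id c = record
  { fun = f ; inv = f ; inv-fun = ff≡id ; fun-inv = ff≡id ; computable = c }

_∘ᵖ_ : ComputablePerm → ComputablePerm → ComputablePerm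
π ∘ᵖ ρ = record
  { fun = π.fun ∘ ρ.fun
  ; inv = ρ.inv ∘ π.inv
  ; inv-fun = λ n → trans (cong ρ.inv (π.inv-fun (ρ.fun n))) (ρ.inv-fun n)
  ; fun-inv = λ n → trans (cong π.fun (ρ.fun-inv (π.inv n))) (π.fun-inv n)
  ; computable = computable-∘ π.computable ρ.computable
  }
  where
  module π = ComputablePerm π
  module ρ = ComputablePerm ρ

flipParity : ℕ → ℕ
flipParity = byParity (suc ∘ dbl) dbl

flipParity-dbl : ∀ k → flipParity (dbl k) ≡ suc (dbl k)
flipParity-dbl = byParity-dbl (suc ∘ dbl) dbl

flipParity-suc-dbl : ∀ k → flipParity (suc (dbl k)) ≡ dbl k
flipParity-suc-dbl = byParity-suc-dbl (suc ∘ dbl) dbl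

flipParity-involutive : ∀ n → flipParity (flipParity n) ≡ n
flipParity-involutive n with parity n
... | even k = trans (cong flipParity (flipParity-dbl k)) (flipParity-suc-dbl k)
... | odd k = trans (cong flipParity (flipParity-suc-dbl k)) (flipParity-dbl k)

computable-flipParity : Computable flipParity
computable-flipParity =
  computable-byParity (computable-∘ computable-suc computable-dbl) computable-dbl

flipParityᵖ : ComputablePerm
flipParityᵖ = involution flipParity flipParity-involutive computable-flipParity

-- swapOddDouble exchanges each odd a with 2a and fixes the multiples of 4.

swapOddDouble : ℕ → ℕ
swapOddDouble = byParity (byParity (dbl ∘ dbl) (suc ∘ dbl)) (dbl ∘ suc ∘ dbl)

swapOddDouble-4* : ∀ j → swapOddDouble (dbl (dbl j)) ≡ dbl (dbl j)
swapOddDouble-4* j =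
  trans (byParity-dbl (byParity (dbl ∘ dbl) (suc ∘ dbl)) (dbl ∘ suc ∘ dbl) (dbl j))
        (byParity-dbl (dbl ∘ dbl) (suc ∘ dbl) j)

swapOddDouble-dbl-odd : ∀ j → swapOddDouble (dbl (suc (dbl j))) ≡ suc (dbl j)
swapOddDouble-dbl-odd j =
  trans (byParity-dbl (byParity (dbl ∘ dbl) (suc ∘ dbl)) (dbl ∘ suc ∘ dbl) (suc (dbl j)))
        (byParity-suc-dbl (dbl ∘ dbl) (suc ∘ dbl) j)

swapOddDouble-odd : ∀ j → swapOddDouble (suc (dbl j)) ≡ dbl (suc (dbl j))
swapOddDouble-odd = byParity-suc-dbl (byParity (dbl ∘ dbl) (suc ∘ dbl)) (dbl ∘ suc ∘ dbl)

swapOddDouble-involutive : ∀ n → swapOddDouble (swapOddDouble n) ≡ n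
swapOddDouble-involutive n with parity n
... | odd k = trans (cong swapOddDouble (swapOddDouble-odd k)) (swapOddDouble-dbl-odd k)
... | even k with parity k
...   | even j = trans (cong swapOddDouble (swapOddDouble-4* j)) (swapOddDouble-4* j)
...   | odd j = trans (cong swapOddDouble (swapOddDouble-dbl-odd j)) (swapOddDouble-odd j)

swapOddDoubleᵖ : ComputablePerm
swapOddDoubleᵖ = involution swapOddDouble swapOddDouble-involutive
  (computable-byParity
    (computable-byParity (computable-∘ computable-dbl computable-dbl)
                         (computable-∘ computable-suc computable-dbl))
    (computable-∘ computable-dbl (computable-∘ computable-suc computable-dbl)))

-- flipSecondBit exchanges 4j and 4j + 2 and fixes the odd numbers.

flipSecondBit : ℕ → ℕ
flipSecondBit = byParity (dbl ∘ flipParity) (suc ∘ dbl)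

flipSecondBit-dbl : ∀ k → flipSecondBit (dbl k) ≡ dbl (flipParity k)
flipSecondBit-dbl = byParity-dbl (dbl ∘ flipParity) (suc ∘ dbl)

flipSecondBit-suc-dbl : ∀ k → flipSecondBit (suc (dbl k)) ≡ suc (dbl k)
flipSecondBit-suc-dbl = byParity-suc-dbl (dbl ∘ flipParity) (suc ∘ dbl)

flipSecondBit-involutive : ∀ n → flipSecondBit (flipSecondBit n) ≡ n
flipSecondBit-involutive n with parity n
... | even k = begin
  flipSecondBit (flipSecondBit (dbl k))  ≡⟨ cong flipSecondBit (flipSecondBit-dbl k) ⟩
  flipSecondBit (dbl (flipParity k))     ≡⟨ flipSecondBit-dbl (flipParity k) ⟩
  dbl (flipParity (flipParity k))        ≡⟨ cong dbl (flipParity-involutive k) ⟩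
  dbl k                                  ∎
  where open ≡-Reasoning
... | odd k = trans (cong flipSecondBit (flipSecondBit-suc-dbl k)) (flipSecondBit-suc-dbl k)

flipSecondBitᵖ : ComputablePerm
flipSecondBitᵖ = involution flipSecondBit flipSecondBit-involutive
  (computable-byParity (computable-∘ computable-dbl computable-flipParity)
                       (computable-∘ computable-suc computable-dbl))

doubleEvenᵖ : ComputablePerm
doubleEvenᵖ = flipSecondBitᵖ ∘ᵖ (swapOddDoubleᵖ ∘ᵖ flipParityᵖ)

doubleEven-dbl : ∀ j → ComputablePerm.fun doubleEvenᵖ (dbl j) ≡ dbl (dbl j)
doubleEven-dbl j = begin
  flipSecondBit (swapOddDouble (flipParity (dbl j)))
    ≡⟨ cong (flipSecondBit ∘ swapOddDouble) (flipParity-dbl j) ⟩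
  flipSecondBit (swapOddDouble (suc (dbl j)))
    ≡⟨ cong flipSecondBit (swapOddDouble-odd j) ⟩
  flipSecondBit (dbl (suc (dbl j)))
    ≡⟨ flipSecondBit-dbl (suc (dbl j)) ⟩
  dbl (flipParity (suc (dbl j)))
    ≡⟨ cong dbl (flipParity-suc-dbl j) ⟩
  dbl (dbl j)
    ∎
  where open ≡-Reasoning

_⊆_ : Subset → Subset → Set
X ⊆ Y = ∀ m → X m ≡ true → Y m ≡ true

_∪_ : Subset → Subset → Subset
(X ∪ Y) m = X m ∨ Y m

∪-introˡ : ∀ X Y → X ⊆ (X ∪ Y)
∪-introˡ X Y m Xm rewrite Xm = refl

∪-introʳ : ∀ X Y → Y ⊆ (X ∪ Y)
∪-introʳ X Y m Ym rewrite Ym = ∨-zeroʳ (X m)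

indicator : Bool → ℕ
indicator b = if b then 1 else 0

count-mono : ∀ {X Y} → X ⊆ Y → ∀ n → count X n ≤ count Y n
count-mono X⊆Y zero = z≤n
count-mono {X} {Y} X⊆Y (suc n) =
  +-mono-≤ (count-mono X⊆Y n) (indicator-mono (X n) (Y n) (X⊆Y n))
  where
  indicator-mono : ∀ x y → (x ≡ true → y ≡ true) → indicator x ≤ indicator y
  indicator-mono false y x⇒y = z≤n
  indicator-mono true y x⇒y rewrite x⇒y refl = ≤-refl

count-∪ : ∀ X Y n → count (X ∪ Y) n ≤ count X n + count Y n
count-∪ X Y zero = z≤n
count-∪ X Y (suc n) = begin
  count (X ∪ Y) n + indicator (X n ∨ Y n)
    ≤⟨ +-mono-≤ (count-∪ X Y n) (indicator-∨ (X n) (Y n)) ⟩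
  (count X n + count Y n) + (indicator (X n) + indicator (Y n))
    ≡⟨ interchange (count X n) (count Y n) (indicator (X n)) (indicator (Y n)) ⟩
  (count X n + indicator (X n)) + (count Y n + indicator (Y n))
    ∎
  where
  open ≤-Reasoning
  indicator-∨ : ∀ x y → indicator (x ∨ y) ≤ indicator x + indicator y
  indicator-∨ false y = ≤-refl
  indicator-∨ true y = s≤s z≤n
  interchange : ∀ a b c d → (a + b) + (c + d) ≡ (a + c) + (b + d)
  interchange = solve-∀

udz-⊆ : ∀ {X Y} → X ⊆ Y → UpperDensityZero Y → UpperDensityZero X
udz-⊆ X⊆Y udzY k with udzY k
... | N , bound =
  N , λ n N≤n → ≤-trans (*-monoʳ-≤ (suc k) (count-mono X⊆Y n)) (bound n N≤n)

-- Bounding the densities of X and Y by 1/(2(k+1)) bounds that of X ∪ Y by 1/(k+1).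
udz-∪ : ∀ {X Y} → UpperDensityZero X → UpperDensityZero Y → UpperDensityZero (X ∪ Y)
udz-∪ {X} {Y} udzX udzY k with udzX (k + suc k) | udzY (k + suc k)
... | N₁ , boundX | N₂ , boundY = N₁ ⊔ N₂ , λ n N≤n →
  ≤-trans (*-monoʳ-≤ (suc k) (count-∪ X Y n))
          (halve (suc k) (count X n) (count Y n) n
                 (boundX n (≤-trans (m≤m⊔n N₁ N₂) N≤n))
                 (boundY n (≤-trans (m≤n⊔m N₁ N₂) N≤n)))
  where
  halve : ∀ s a b n → (s + s) * a ≤ n → (s + s) * b ≤ n → s * (a + b) ≤ n
  halve s a b n sa≤n sb≤n = *-cancelˡ-≤ 2 (begin
    2 * (s * (a + b))          ≡⟨ distribute s a b ⟩
    (s + s) * a + (s + s) * b  ≤⟨ +-mono-≤ sa≤n sb≤n ⟩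
    n + n                      ≡⟨ +-*2 n ⟩
    2 * n                      ∎)
    where
    open ≤-Reasoning
    distribute : ∀ s a b → 2 * (s * (a + b)) ≡ (s + s) * a + (s + s) * b
    distribute = solve-∀
    +-*2 : ∀ n → n + n ≡ 2 * n
    +-*2 = solve-∀

idz-⊆ : ∀ {X Y} → X ⊆ Y → IntrinsicDensityZero Y → IntrinsicDensityZero X
idz-⊆ X⊆Y idzY π = udz-⊆ (X⊆Y ∘ ComputablePerm.inv π) (idzY π)

idz-∪ : ∀ X Y → IntrinsicDensityZero X → IntrinsicDensityZero Y →
        IntrinsicDensityZero (X ∪ Y)
idz-∪ X Y idzX idzY π = udz-∪ (idzX π) (idzY π)

idz-image : ∀ ρ X → IntrinsicDensityZero X → IntrinsicDensityZero (image ρ X)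
idz-image ρ X idzX π = idzX (π ∘ᵖ ρ)

n*2%2≡0 : ∀ n → n * 2 % 2 ≡ 0
n*2%2≡0 n = m*n%n≡0 n 2

n*2/2≡n : ∀ n → n * 2 / 2 ≡ n
n*2/2≡n n = m*n/n≡m n 2

[1+n*2]%2≡1 : ∀ n → (1 + n * 2) % 2 ≡ 1
[1+n*2]%2≡1 n = [m+kn]%n≡m%n 1 n 2

[1+n*2]/2≡n : ∀ n → (1 + n * 2) / 2 ≡ n
[1+n*2]/2≡n n = trans (+-distrib-/ 1 (n * 2) 1+[n*2%2]<2) (n*2/2≡n n)
  where
  1+[n*2%2]<2 : 1 + n * 2 % 2 < 2
  1+[n*2%2]<2 rewrite n*2%2≡0 n = ≤-refl

⊕-dbl : ∀ A B a → (A ⊕ B) (dbl a) ≡ A a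
⊕-dbl A B a rewrite dbl≡*2 a | n*2%2≡0 a | n*2/2≡n a = refl

⊕-suc-dbl : ∀ A B b → (A ⊕ B) (suc (dbl b)) ≡ B b
⊕-suc-dbl A B b rewrite dbl≡*2 b | [1+n*2]%2≡1 b | [1+n*2]/2≡n b = refl

image-∋ : ∀ ρ X a {m} → ComputablePerm.fun ρ a ≡ m → X a ≡ true → image ρ X m ≡ true
image-∋ ρ X a refl a∈X = subst (λ b → X b ≡ true) (sym (ComputablePerm.inv-fun ρ a)) a∈X

∅ : Subset
∅ _ = false

⊕-⊆ : ∀ A B → (A ⊕ B) ⊆ ((A ⊕ ∅) ∪ image flipParityᵖ (B ⊕ ∅))
⊕-⊆ A B m m∈A⊕B with parity m
... | even a = ∪-introˡ (A ⊕ ∅) (image flipParityᵖ (B ⊕ ∅)) (dbl a)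
  (trans (⊕-dbl A ∅ a) (trans (sym (⊕-dbl A B a)) m∈A⊕B))
... | odd b = ∪-introʳ (A ⊕ ∅) (image flipParityᵖ (B ⊕ ∅)) (suc (dbl b))
  (image-∋ flipParityᵖ (B ⊕ ∅) (dbl b) (flipParity-dbl b)
    (trans (⊕-dbl B ∅ b) (trans (sym (⊕-suc-dbl A B b)) m∈A⊕B)))

⊕∅-⊆ : ∀ A → (A ⊕ ∅) ⊆ (image swapOddDoubleᵖ A ∪ image doubleEvenᵖ A)
⊕∅-⊆ A m m∈A⊕∅ with parity m
⊕∅-⊆ A _ m∈A⊕∅ | odd b with trans (sym (⊕-suc-dbl A ∅ b)) m∈A⊕∅
... | ()
⊕∅-⊆ A _ m∈A⊕∅ | even a with parity a | trans (sym (⊕-dbl A ∅ a)) m∈A⊕∅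
... | odd k | a∈A =
  ∪-introˡ (image swapOddDoubleᵖ A) (image doubleEvenᵖ A) (dbl (suc (dbl k)))
    (image-∋ swapOddDoubleᵖ A (suc (dbl k)) (swapOddDouble-odd k) a∈A)
... | even j | a∈A =
  ∪-introʳ (image swapOddDoubleᵖ A) (image doubleEvenᵖ A) (dbl (dbl j))
    (image-∋ doubleEvenᵖ A (dbl j) (doubleEven-dbl j) a∈A)

idz-⊕∅ : ∀ A → IntrinsicDensityZero A → IntrinsicDensityZero (A ⊕ ∅)
idz-⊕∅ A idzA = idz-⊆ (⊕∅-⊆ A)
  (idz-∪ (image swapOddDoubleᵖ A) (image doubleEvenᵖ A)
         (idz-image swapOddDoubleᵖ A idzA) (idz-image doubleEvenᵖ A idzA))

infinite-⊕ : ∀ {A} B → Infinite A → Infinite (A ⊕ B)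
infinite-⊕ {A} B infA n with infA n
... | a , n≤a , a∈A = dbl a , ≤-trans n≤a (n≤dbl a) , trans (⊕-dbl A B a) a∈A

corollary2p7 : (A B : Subset) → IntrinsicallySmall A → IntrinsicallySmall B →
    IntrinsicallySmall (A ⊕ B)
corollary2p7 A B (infA , idzA) (_ , idzB) =
  infinite-⊕ B infA ,
  idz-⊆ (⊕-⊆ A B) (idz-∪ (A ⊕ ∅) (image flipParityᵖ (B ⊕ ∅))
    (idz-⊕∅ A idzA) (idz-image flipParityᵖ (B ⊕ ∅) (idz-⊕∅ B idzB)))
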